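{- Let $1\le k\le n$. There are exactly $(n-k)!\,(k-1)!$ permutations $\pi\in S_n$ such that $\{k\}$ is a dominating set of $G_\pi$.
   Context: For a permutation $\pi$ of $[n]=\{1,\dots,n\}$ (one-line notation $[\pi(1),\dots,\pi(n)]$), the permutation graph $G_\pi$ has vertex set $[n]$ and an edge between $i<j$ iff $\pi^{ -1}(i)>\pi^{ -1}(j)$. A set $D$ dominates $G_\pi$ if every vertex is in $D$ or adjacent to a vertex of $D$. -}

module Defs where

open import Data.Nat using (ℕ; _<_; _≤_)
open import Data.Fin using (Fin)
open import Data.Vec using (Vec; lookup; toList)
open import Data.List.Relation.Unary.All using (All)
open import Data.List.Relation.Unary.Unique.Propositional using (Unique)
open import Data.Product using (_×_; ∃₂)
open import Data.Sum using (_⊎_)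
open import Relation.Binary.PropositionalEquality using (_≡_)

-- One-line notation: π = [π(1),…,π(n)] stored as a vector of naturals
-- (position a : Fin n holds the value π(a+1)).
IsPermutation : {n : ℕ} → Vec ℕ n → Set
IsPermutation {n} π = All (λ x → 1 ≤ x × x ≤ n) (toList π) × Unique (toList π)

-- Edge of the permutation graph G_π between vertices i and j:
-- i < j and π⁻¹(i) > π⁻¹(j) (or the symmetric case j < i).
Adj : {n : ℕ} → Vec ℕ n → ℕ → ℕ → Set
Adj {n} π i j =
  ∃₂ λ (a b : Fin n) → lookup π a ≡ i × lookup π b ≡ j ×
    ((i < j × Data.Fin._<_ b a) ⊎ (j < i × Data.Fin._<_ a b))

Dominates : {n : ℕ} → Vec ℕ n → (ℕ → Set) → Set
Dominates {n} π D =
  (v : ℕ) → 1 ≤ v → v ≤ n → D v ⊎ (∃₂ λ d (_ : D d) → Adj π d v)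

Singleton : ℕ → ℕ → Set
Singleton k v = v ≡ k

module Submission where

-- A vertex v ≠ k of G_π is adjacent to k
-- exactly when (k, v) is an inversion, so {k} dominates G_π iff every value
-- above k occurs before k in π and every value below k occurs after k.  The
-- permutations with this property are therefore exactly the words
--     xs ++ k ∷ ys,   xs an arrangement of {k+1,…,n},  ys one of {1,…,k-1},
-- and there are (n-k)! · (k-1)! of them.

open import Defs
open import Data.Nat using (ℕ; zero; suc; _+_; _*_; _∸_; _≤_; _<_; _!; z≤n; s≤s)
open import Data.Nat.Properties
open import Data.Fin as Fin using (Fin; zero; suc)
open import Data.Vec using (Vec; []; _∷_; lookup; toList)
open import Data.Vec.Properties using (length-toList)
import Data.Vec.Relation.Unary.Any as VecAny
open import Data.Vec.Relation.Unary.Any.Properties using (lookup-index)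
open import Data.Vec.Membership.Propositional.Properties using (∈-lookup; ∈-toList⁺; ∈-toList⁻)
open import Data.List using (List; []; _∷_; _++_; length; map; concatMap; applyUpTo; cartesianProduct)
open import Data.List.Properties using (∷-injectiveˡ; ∷-injectiveʳ; length-++; length-map; length-applyUpTo)
open import Data.List.Relation.Unary.Any using (here; there)
open import Data.List.Relation.Unary.All as All using (All; []; _∷_)
open import Data.List.Relation.Unary.All.Properties using (All¬⇒¬Any; ¬Any⇒All¬)
open import Data.List.Relation.Unary.AllPairs using ([]; _∷_)
open import Data.List.Relation.Unary.Unique.Propositional using (Unique)
open import Data.List.Relation.Unary.Unique.Propositional.Properties
  using (++⁺; map⁺; applyUpTo⁺₁; cartesianProduct⁺)
open import Data.List.Relation.Binary.Disjoint.Propositional using (Disjoint)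
open import Data.List.Relation.Binary.Subset.Propositional using (_⊆_)
open import Data.List.Membership.Propositional using (_∈_; _∉_; find; lose)
open import Data.List.Membership.Propositional.Properties
  using (∈-++⁺ˡ; ∈-++⁺ʳ; ∈-++⁻; ∈-map⁺; ∈-map⁻; ∈-∃++; ∈-concatMap⁺; ∈-concatMap⁻;
         ∈-applyUpTo⁺; ∈-applyUpTo⁻; ∈-cartesianProduct⁺; ∈-cartesianProduct⁻)
open import Data.Product using (Σ; ∃₂; _×_; _,_; proj₁; proj₂)
open import Data.Sum using (_⊎_; inj₁; inj₂; [_,_]′)
open import Data.Empty using (⊥-elim)
open import Function.Base using (_∘_)
open import Function.Bundles using (_⇔_; mk⇔)
open import Relation.Binary.PropositionalEquality
  using (_≡_; refl; sym; trans; cong; cong₂; subst; module ≡-Reasoning)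
open import Relation.Binary.Definitions using (tri<; tri≈; tri>)

private
  variable
    A B : Set

Unique-++⁻ : (xs : List A) {ys : List A} → Unique (xs ++ ys) →
  Unique xs × Unique ys × Disjoint xs ys
Unique-++⁻ [] u = [] , u , λ ()
Unique-++⁻ (x ∷ xs) (x∉ ∷ u) with Unique-++⁻ xs u
... | uxs , uys , disjoint =
  ¬Any⇒All¬ xs (λ x∈xs → All¬⇒¬Any x∉ (∈-++⁺ˡ x∈xs)) ∷ uxs , uys ,
  λ { (here refl , v∈ys) → All¬⇒¬Any x∉ (∈-++⁺ʳ xs v∈ys)
    ; (there v∈xs , v∈ys) → disjoint (v∈xs , v∈ys) }

∈-mid⁻ : (xs : List A) {x z : A} {ys : List A} → z ∈ xs ++ x ∷ ys → z ≡ x ⊎ z ∈ xs ++ ys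
∈-mid⁻ xs z∈ with ∈-++⁻ xs z∈
... | inj₁ z∈xs = inj₂ (∈-++⁺ˡ z∈xs)
... | inj₂ (here z≡x) = inj₁ z≡x
... | inj₂ (there z∈ys) = inj₂ (∈-++⁺ʳ xs z∈ys)

∈-mid⁺ : (xs : List A) {x z : A} {ys : List A} → z ∈ xs ++ ys → z ∈ xs ++ x ∷ ys
∈-mid⁺ xs z∈ with ∈-++⁻ xs z∈
... | inj₁ z∈xs = ∈-++⁺ˡ z∈xs
... | inj₂ z∈ys = ∈-++⁺ʳ xs (there z∈ys)

Unique-mid⁻ : (xs : List A) {x : A} {ys : List A} → Unique (xs ++ x ∷ ys) →
  Unique (xs ++ ys) × x ∉ xs ++ ys
Unique-mid⁻ xs u with Unique-++⁻ xs u
... | uxs , x∉ys ∷ uys , disjoint =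
  ++⁺ uxs uys (λ (v∈xs , v∈ys) → disjoint (v∈xs , there v∈ys)) ,
  λ x∈ → [ (λ x∈xs → disjoint (x∈xs , here refl)) , All¬⇒¬Any x∉ys ]′ (∈-++⁻ xs x∈)

Unique-mid⁺ : (xs : List A) {x : A} {ys : List A} → Unique (xs ++ ys) → x ∉ xs ++ ys →
  Unique (xs ++ x ∷ ys)
Unique-mid⁺ xs {ys = ys} u x∉ with Unique-++⁻ xs u
... | uxs , uys , disjoint =
  ++⁺ uxs (¬Any⇒All¬ ys (λ x∈ys → x∉ (∈-++⁺ʳ xs x∈ys)) ∷ uys)
    λ { (v∈xs , here refl) → x∉ (∈-++⁺ˡ v∈xs)
      ; (v∈xs , there v∈ys) → disjoint (v∈xs , v∈ys) }

split-unique : (xs xs' : List A) {x : A} {ys ys' : List A} → x ∉ xs → x ∉ xs' →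
  xs ++ x ∷ ys ≡ xs' ++ x ∷ ys' → xs ≡ xs' × ys ≡ ys'
split-unique [] [] _ _ refl = refl , refl
split-unique [] (y ∷ xs') _ x∉xs' eq = ⊥-elim (x∉xs' (here (∷-injectiveˡ eq)))
split-unique (y ∷ xs) [] x∉xs _ eq = ⊥-elim (x∉xs (here (sym (∷-injectiveˡ eq))))
split-unique (y ∷ xs) (y' ∷ xs') x∉xs x∉xs' eq
  with ∷-injectiveˡ eq
     | split-unique xs xs' (λ p → x∉xs (there p)) (λ p → x∉xs' (there p)) (∷-injectiveʳ eq)
... | refl | refl , ys≡ys' = refl , ys≡ys'

Unique-map : (f : A → B) {xs : List A} →
  (∀ {x y} → x ∈ xs → y ∈ xs → f x ≡ f y → x ≡ y) → Unique xs → Unique (map f xs)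
Unique-map f {[]} _ [] = []
Unique-map f {x ∷ xs} injective (x∉ ∷ u) =
  ¬Any⇒All¬ (map f xs) fx∉ ∷ Unique-map f (λ p q → injective (there p) (there q)) u
  where
  fx∉ : f x ∉ map f xs
  fx∉ fx∈ with ∈-map⁻ f fx∈
  ... | y , y∈xs , fx≡fy = All¬⇒¬Any x∉ (subst (_∈ xs) (sym (injective (here refl) (there y∈xs) fx≡fy)) y∈xs)

Unique-concatMap : (f : A → List B) {xs : List A} → Unique xs →
  (∀ {x} → x ∈ xs → Unique (f x)) →
  (∀ {x x' y} → x ∈ xs → x' ∈ xs → y ∈ f x → y ∈ f x' → x ≡ x') →
  Unique (concatMap f xs)
Unique-concatMap f {[]} [] _ _ = []
Unique-concatMap f {x ∷ xs} (x∉ ∷ u) unique-block disjoint-blocks =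
  ++⁺ (unique-block (here refl))
      (Unique-concatMap f u (λ p → unique-block (there p))
                            (λ p q → disjoint-blocks (there p) (there q)))
      λ (y∈fx , y∈rest) → apart y∈fx y∈rest
  where
  apart : ∀ {y} → y ∈ f x → y ∉ concatMap f xs
  apart y∈fx y∈rest with find (∈-concatMap⁻ f y∈rest)
  ... | x' , x'∈xs , y∈fx' =
    All¬⇒¬Any x∉ (subst (_∈ xs) (sym (disjoint-blocks (here refl) (there x'∈xs) y∈fx y∈fx')) x'∈xs)

length-concatMap : (f : A → List B) (c : ℕ) (xs : List A) →
  (∀ {x} → x ∈ xs → length (f x) ≡ c) → length (concatMap f xs) ≡ length xs * c
length-concatMap f c [] _ = refl
length-concatMap f c (x ∷ xs) block-length =
  trans (length-++ (f x))
        (cong₂ _+_ (block-length (here refl))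
                   (length-concatMap f c xs (λ p → block-length (there p))))

length-cartesianProduct : (xs : List A) (ys : List B) →
  length (cartesianProduct xs ys) ≡ length xs * length ys
length-cartesianProduct [] ys = refl
length-cartesianProduct (x ∷ xs) ys =
  trans (length-++ (map (x ,_) ys))
        (cong₂ _+_ (length-map (x ,_) ys) (length-cartesianProduct xs ys))

-- Arrangements of a list.

_IsArrangementOf_ : List A → List A → Set
m IsArrangementOf l = Unique m × m ⊆ l × l ⊆ m

insertions : A → List A → List (List A)
insertions x [] = (x ∷ []) ∷ []
insertions x (y ∷ ys) = (x ∷ y ∷ ys) ∷ map (y ∷_) (insertions x ys)

length-insertions : (x : A) (ys : List A) → length (insertions x ys) ≡ suc (length ys)
length-insertions x [] = refl
length-insertions x (y ∷ ys) =
  cong suc (trans (length-map (y ∷_) (insertions x ys)) (length-insertions x ys))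

∈-insertions⁻ : (x : A) (ys : List A) {m : List A} → m ∈ insertions x ys →
  ∃₂ λ as bs → ys ≡ as ++ bs × m ≡ as ++ x ∷ bs
∈-insertions⁻ x [] (here refl) = [] , [] , refl , refl
∈-insertions⁻ x (y ∷ ys) (here refl) = [] , y ∷ ys , refl , refl
∈-insertions⁻ x (y ∷ ys) (there p) with ∈-map⁻ (y ∷_) p
... | m' , m'∈ , refl with ∈-insertions⁻ x ys m'∈
... | as , bs , refl , refl = y ∷ as , bs , refl , refl

∈-insertions⁺ : (x : A) (as bs : List A) → as ++ x ∷ bs ∈ insertions x (as ++ bs)
∈-insertions⁺ x [] [] = here refl
∈-insertions⁺ x [] (b ∷ bs) = here refl
∈-insertions⁺ x (a ∷ as) bs = there (∈-map⁺ (a ∷_) (∈-insertions⁺ x as bs))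

Unique-insertions : (x : A) (ys : List A) → x ∉ ys → Unique (insertions x ys)
Unique-insertions x [] _ = [] ∷ []
Unique-insertions x (y ∷ ys) x∉ =
  ¬Any⇒All¬ _ head-fresh ∷ map⁺ ∷-injectiveʳ (Unique-insertions x ys (λ p → x∉ (there p)))
  where
  head-fresh : (x ∷ y ∷ ys) ∉ map (y ∷_) (insertions x ys)
  head-fresh p with ∈-map⁻ (y ∷_) p
  ... | _ , _ , eq = x∉ (here (∷-injectiveˡ eq))

insertions-disjoint : (x : A) {ys ys' m : List A} → x ∉ ys → x ∉ ys' →
  m ∈ insertions x ys → m ∈ insertions x ys' → ys ≡ ys'
insertions-disjoint x x∉ys x∉ys' p p'
  with ∈-insertions⁻ x _ p | ∈-insertions⁻ x _ p'
... | as , bs , refl , refl | as' , bs' , refl , eq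
  with split-unique as as' (λ q → x∉ys (∈-++⁺ˡ q)) (λ q → x∉ys' (∈-++⁺ˡ q)) eq
... | refl , refl = refl

arrangements : List A → List (List A)
arrangements [] = [] ∷ []
arrangements (x ∷ xs) = concatMap (insertions x) (arrangements xs)

length-mid : (as : List A) {x : A} (bs : List A) → length (as ++ x ∷ bs) ≡ suc (length (as ++ bs))
length-mid as bs = begin
  length (as ++ _ ∷ bs)         ≡⟨ length-++ as ⟩
  length as + suc (length bs)   ≡⟨ +-suc (length as) (length bs) ⟩
  suc (length as + length bs)   ≡⟨ cong suc (length-++ as) ⟨
  suc (length (as ++ bs))       ∎
  where open ≡-Reasoning

length-∈-arrangements : (l : List A) {m : List A} → m ∈ arrangements l → length m ≡ length l
length-∈-arrangements [] (here refl) = refl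
length-∈-arrangements (x ∷ xs) p with find (∈-concatMap⁻ (insertions x) p)
... | m' , m'∈ , m∈ with ∈-insertions⁻ x m' m∈
... | as , bs , refl , refl = trans (length-mid as bs) (cong suc (length-∈-arrangements xs m'∈))

arrangements-sound : (l : List A) {m : List A} → Unique l → m ∈ arrangements l →
  m IsArrangementOf l
arrangements-sound [] _ (here refl) = [] , (λ ()) , (λ ())
arrangements-sound (x ∷ xs) (x∉xs ∷ u) p with find (∈-concatMap⁻ (insertions x) p)
... | m' , m'∈ , m∈ with ∈-insertions⁻ x m' m∈
... | as , bs , refl , refl with arrangements-sound xs u m'∈
... | u' , sub , sup =
  Unique-mid⁺ as u' (λ x∈ → All¬⇒¬Any x∉xs (sub x∈)) ,
  (λ z∈ → [ (λ { refl → here refl }) , (λ z∈' → there (sub z∈')) ]′ (∈-mid⁻ as z∈)) ,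
  (λ { (here refl) → ∈-++⁺ʳ as (here refl) ; (there z∈xs) → ∈-mid⁺ as (sup z∈xs) })

arrangements-complete : (l : List A) {m : List A} → Unique l → m IsArrangementOf l →
  m ∈ arrangements l
arrangements-complete [] {[]} _ _ = here refl
arrangements-complete [] {z ∷ m} _ (_ , sub , _) with sub (here refl)
... | ()
arrangements-complete (x ∷ xs) (x∉xs ∷ u) (um , sub , sup) with ∈-∃++ (sup (here refl))
... | as , bs , refl with Unique-mid⁻ as um
... | u' , x∉ =
  ∈-concatMap⁺ (insertions x)
    (lose (arrangements-complete xs u (u' , sub' , sup')) (∈-insertions⁺ x as bs))
  where
  sub' : as ++ bs ⊆ xs
  sub' z∈ with sub (∈-mid⁺ as z∈)
  ... | here refl = ⊥-elim (x∉ z∈)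
  ... | there z∈xs = z∈xs
  sup' : xs ⊆ as ++ bs
  sup' z∈xs with ∈-mid⁻ as (sup (there z∈xs))
  ... | inj₁ refl = ⊥-elim (All¬⇒¬Any x∉xs z∈xs)
  ... | inj₂ z∈ = z∈

Unique-arrangements : (l : List A) → Unique l → Unique (arrangements l)
Unique-arrangements [] _ = [] ∷ []
Unique-arrangements (x ∷ xs) (x∉xs ∷ u) =
  Unique-concatMap (insertions x) (Unique-arrangements xs u)
    (λ p → Unique-insertions x _ (fresh p))
    (λ p p' → insertions-disjoint x (fresh p) (fresh p'))
  where
  fresh : ∀ {m} → m ∈ arrangements xs → x ∉ m
  fresh p x∈ = All¬⇒¬Any x∉xs (proj₁ (proj₂ (arrangements-sound xs u p)) x∈)

length-arrangements : (l : List A) → length (arrangements l) ≡ length l !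
length-arrangements [] = refl
length-arrangements (x ∷ xs) = begin
  length (concatMap (insertions x) (arrangements xs))
    ≡⟨ length-concatMap (insertions x) (suc (length xs)) (arrangements xs) block-length ⟩
  length (arrangements xs) * suc (length xs)
    ≡⟨ cong (_* suc (length xs)) (length-arrangements xs) ⟩
  length xs ! * suc (length xs)
    ≡⟨ *-comm (length xs !) (suc (length xs)) ⟩
  suc (length xs) * length xs !  ∎
  where
  open ≡-Reasoning
  block-length : ∀ {m} → m ∈ arrangements xs → length (insertions x m) ≡ suc (length xs)
  block-length {m} p = trans (length-insertions x m) (cong suc (length-∈-arrangements xs p))

interval : ℕ → ℕ → List ℕ
interval lo len = applyUpTo (lo +_) len

∈-interval⁻ : ∀ {lo len z} → z ∈ interval lo len → lo ≤ z × z < lo + len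
∈-interval⁻ {lo} z∈ with ∈-applyUpTo⁻ (lo +_) z∈
... | i , i<len , refl = m≤m+n lo i , +-monoʳ-< lo i<len

∈-interval⁺ : ∀ {lo len z} → lo ≤ z → z < lo + len → z ∈ interval lo len
∈-interval⁺ {lo} {len} {z} lo≤z z<end =
  subst (_∈ interval lo len) (m+[n∸m]≡n lo≤z) (∈-applyUpTo⁺ (lo +_) offset<len)
  where
  offset<len : z ∸ lo < len
  offset<len = subst (z ∸ lo <_) (m+n∸m≡n lo len) (∸-monoˡ-< z<end lo≤z)

Unique-interval : ∀ lo len → Unique (interval lo len)
Unique-interval lo len = applyUpTo⁺₁ (lo +_) len (λ i<j _ → <⇒≢ (+-monoʳ-< lo i<j))

-- A list read as a vector of length n (padded with 0 when too short).
toVec : (n : ℕ) → List ℕ → Vec ℕ n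
toVec zero _ = []
toVec (suc n) [] = 0 ∷ toVec n []
toVec (suc n) (x ∷ l) = x ∷ toVec n l

toList-toVec : (n : ℕ) (l : List ℕ) → length l ≡ n → toList (toVec n l) ≡ l
toList-toVec zero [] _ = refl
toList-toVec (suc n) (x ∷ l) eq = cong (x ∷_) (toList-toVec n l (suc-injective eq))

toVec-toList : {n : ℕ} (π : Vec ℕ n) → toVec n (toList π) ≡ π
toVec-toList [] = refl
toVec-toList (x ∷ π) = cong (x ∷_) (toVec-toList π)

data Precedes {A : Set} : List A → A → A → Set where
  at-head : ∀ {x y l} → y ∈ l → Precedes (x ∷ l) x y
  in-tail : ∀ {x y z l} → Precedes l x y → Precedes (z ∷ l) x y

precedes-∈ˡ : ∀ {l : List A} {x y} → Precedes l x y → x ∈ l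
precedes-∈ˡ (at-head _) = here refl
precedes-∈ˡ (in-tail p) = there (precedes-∈ˡ p)

precedes-∈ʳ : ∀ {l : List A} {x y} → Precedes l x y → y ∈ l
precedes-∈ʳ (at-head y∈) = there y∈
precedes-∈ʳ (in-tail p) = there (precedes-∈ʳ p)

positions⇒precedes : ∀ {n} (π : Vec A n) (a b : Fin n) → a Fin.< b →
  Precedes (toList π) (lookup π a) (lookup π b)
positions⇒precedes (_ ∷ π) zero (suc b) _ = at-head (∈-toList⁺ (∈-lookup b π))
positions⇒precedes (_ ∷ π) (suc a) (suc b) (s≤s a<b) = in-tail (positions⇒precedes π a b a<b)

precedes⇒positions : ∀ {n} (π : Vec A n) {x y} → Precedes (toList π) x y →
  ∃₂ λ a b → lookup π a ≡ x × lookup π b ≡ y × a Fin.< b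
precedes⇒positions (_ ∷ π) (at-head y∈) =
  let y∈π = ∈-toList⁻ y∈ in
  zero , suc (VecAny.index y∈π) , refl , sym (lookup-index y∈π) , s≤s z≤n
precedes⇒positions (_ ∷ π) (in-tail p) with precedes⇒positions π p
... | a , b , πa≡x , πb≡y , a<b = suc a , suc b , πa≡x , πb≡y , s≤s a<b

precedes-mid-left : (xs : List A) {k v : A} {ys : List A} → v ∈ xs → Precedes (xs ++ k ∷ ys) v k
precedes-mid-left (_ ∷ xs) (here refl) = at-head (∈-++⁺ʳ xs (here refl))
precedes-mid-left (_ ∷ xs) (there v∈) = in-tail (precedes-mid-left xs v∈)

precedes-mid-right : (xs : List A) {k v : A} {ys : List A} → v ∈ ys → Precedes (xs ++ k ∷ ys) k v
precedes-mid-right [] v∈ = at-head v∈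
precedes-mid-right (_ ∷ xs) v∈ = in-tail (precedes-mid-right xs v∈)

before-mid : (xs : List A) {k v : A} {ys : List A} → k ∉ ys → Precedes (xs ++ k ∷ ys) v k → v ∈ xs
before-mid [] k∉ys (at-head k∈ys) = ⊥-elim (k∉ys k∈ys)
before-mid [] k∉ys (in-tail p) = ⊥-elim (k∉ys (precedes-∈ʳ p))
before-mid (_ ∷ xs) k∉ys (at-head _) = here refl
before-mid (_ ∷ xs) k∉ys (in-tail p) = there (before-mid xs k∉ys p)

after-mid : (xs : List A) {k v : A} {ys : List A} → k ∉ xs → k ∉ ys → Precedes (xs ++ k ∷ ys) k v → v ∈ ys
after-mid [] _ k∉ys (at-head v∈ys) = v∈ys
after-mid [] _ k∉ys (in-tail p) = ⊥-elim (k∉ys (precedes-∈ˡ p))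
after-mid (_ ∷ xs) k∉xs k∉ys (at-head _) = ⊥-elim (k∉xs (here refl))
after-mid (_ ∷ xs) k∉xs k∉ys (in-tail p) = after-mid xs (λ q → k∉xs (there q)) k∉ys p

InRange : ℕ → List ℕ → Set
InRange n l = All (λ x → 1 ≤ x × x ≤ n) l

KDominated : ℕ → ℕ → List ℕ → Set
KDominated n k l = ∀ v → 1 ≤ v → v ≤ n →
  v ≡ k ⊎ (k < v × Precedes l v k) ⊎ (v < k × Precedes l k v)

dominates⇒KDominated : ∀ {n k} (π : Vec ℕ n) → Dominates π (Singleton k) → KDominated n k (toList π)
dominates⇒KDominated π dom v 1≤v v≤n with dom v 1≤v v≤n
... | inj₁ v≡k = inj₁ v≡k
... | inj₂ (_ , refl , a , b , refl , refl , inj₁ (k<v , b<a)) = inj₂ (inj₁ (k<v , positions⇒precedes π b a b<a))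
... | inj₂ (_ , refl , a , b , refl , refl , inj₂ (v<k , a<b)) = inj₂ (inj₂ (v<k , positions⇒precedes π a b a<b))

KDominated⇒dominates : ∀ {n k} (π : Vec ℕ n) → KDominated n k (toList π) → Dominates π (Singleton k)
KDominated⇒dominates {k = k} π dom v 1≤v v≤n with dom v 1≤v v≤n
... | inj₁ v≡k = inj₁ v≡k
... | inj₂ (inj₁ (k<v , v-before-k)) with precedes⇒positions π v-before-k
...   | a , b , πa≡v , πb≡k , a<b = inj₂ (k , refl , b , a , πb≡k , πa≡v , inj₁ (k<v , a<b))
KDominated⇒dominates {k = k} π dom v 1≤v v≤n | inj₂ (inj₂ (v<k , k-before-v)) with precedes⇒positions π k-before-v
...   | a , b , πa≡k , πb≡v , a<b = inj₂ (k , refl , a , b , πa≡k , πb≡v , inj₂ (v<k , a<b))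

-- When k = n, the vertex k occurs: it must precede 1, unless n = 1 and l = [1].
last-vertex-occurs : ∀ k l → 1 ≤ k → length l ≡ k → InRange k l → KDominated k k l → k ∈ l
last-vertex-occurs (suc zero) (x ∷ []) _ _ ((s≤s z≤n , s≤s z≤n) ∷ []) _ = here refl
last-vertex-occurs (suc (suc j)) l _ _ _ dom with dom 1 ≤-refl (s≤s z≤n)
... | inj₁ ()
... | inj₂ (inj₁ (s≤s () , _))
... | inj₂ (inj₂ (_ , k-before-1)) = precedes-∈ˡ k-before-1

-- In a list of length n dominated by {k}, the vertex k occurs: for k < n it
-- must follow n.
dominating-vertex-occurs : ∀ n k l → 1 ≤ k → k ≤ n → length l ≡ n → InRange n l →
  KDominated n k l → k ∈ l
dominating-vertex-occurs n k l 1≤k k≤n len range dom with m≤n⇒m<n∨m≡n k≤n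
... | inj₂ refl = last-vertex-occurs k l 1≤k len range dom
... | inj₁ k<n with dom n (≤-trans 1≤k k≤n) ≤-refl
...   | inj₁ n≡k = ⊥-elim (<-irrefl (sym n≡k) k<n)
...   | inj₂ (inj₁ (_ , n-before-k)) = precedes-∈ʳ n-before-k
...   | inj₂ (inj₂ (n<k , _)) = ⊥-elim (<-asym k<n n<k)

module Sandwich (n k : ℕ) (1≤k : 1 ≤ k) (k≤n : k ≤ n) where

  Above Below : List ℕ
  Above = interval (suc k) (n ∸ k)
  Below = interval 1 (k ∸ 1)

  ∈-Above⁻ : ∀ {z} → z ∈ Above → k < z × z ≤ n
  ∈-Above⁻ {z} z∈ with ∈-interval⁻ z∈
  ... | k<z , s≤s z≤end = k<z , subst (z ≤_) (m+[n∸m]≡n k≤n) z≤end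

  ∈-Above⁺ : ∀ {z} → k < z → z ≤ n → z ∈ Above
  ∈-Above⁺ {z} k<z z≤top = ∈-interval⁺ k<z (s≤s (subst (z ≤_) (sym (m+[n∸m]≡n k≤n)) z≤top))

  ∈-Below⁻ : ∀ {z} → z ∈ Below → 1 ≤ z × z < k
  ∈-Below⁻ {z} z∈ with ∈-interval⁻ z∈
  ... | 1≤z , z<end = 1≤z , subst (z <_) (m+[n∸m]≡n 1≤k) z<end

  ∈-Below⁺ : ∀ {z} → 1 ≤ z → z < k → z ∈ Below
  ∈-Below⁺ {z} 1≤z z<k = ∈-interval⁺ 1≤z (subst (z <_) (sym (m+[n∸m]≡n 1≤k)) z<k)

  Good : List ℕ → Set
  Good l = InRange n l × Unique l × KDominated n k l

  sandwich-sound : ∀ {xs ys} → xs IsArrangementOf Above → ys IsArrangementOf Below →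
    Good (xs ++ k ∷ ys)
  sandwich-sound {xs} {ys} (uxs , xs⊆ , ⊆xs) (uys , ys⊆ , ⊆ys) = All.tabulate in-range , unique , dominated
    where
    in-range : ∀ {z} → z ∈ xs ++ k ∷ ys → 1 ≤ z × z ≤ n
    in-range z∈ with ∈-mid⁻ xs z∈
    ... | inj₁ refl = 1≤k , k≤n
    ... | inj₂ z∈' with ∈-++⁻ xs z∈'
    ...   | inj₁ z∈xs = let k<z , z≤top = ∈-Above⁻ (xs⊆ z∈xs) in ≤-trans 1≤k (<⇒≤ k<z) , z≤top
    ...   | inj₂ z∈ys = let 1≤z , z<k = ∈-Below⁻ (ys⊆ z∈ys) in 1≤z , ≤-trans (<⇒≤ z<k) k≤n
    unique : Unique (xs ++ k ∷ ys)
    unique = Unique-mid⁺ xs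
      (++⁺ uxs uys (λ (z∈xs , z∈ys) → <-asym (proj₁ (∈-Above⁻ (xs⊆ z∈xs))) (proj₂ (∈-Below⁻ (ys⊆ z∈ys)))))
      (λ k∈ → [ (λ k∈xs → <-irrefl refl (proj₁ (∈-Above⁻ (xs⊆ k∈xs))))
              , (λ k∈ys → <-irrefl refl (proj₂ (∈-Below⁻ (ys⊆ k∈ys)))) ]′ (∈-++⁻ xs k∈))
    dominated : KDominated n k (xs ++ k ∷ ys)
    dominated v 1≤v v≤n with <-cmp v k
    ... | tri< v<k _ _ = inj₂ (inj₂ (v<k , precedes-mid-right xs (⊆ys (∈-Below⁺ 1≤v v<k))))
    ... | tri≈ _ v≡k _ = inj₁ v≡k
    ... | tri> _ _ k<v = inj₂ (inj₁ (k<v , precedes-mid-left xs (⊆xs (∈-Above⁺ k<v v≤n))))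

  sandwich-complete : ∀ {l} → length l ≡ n → Good l →
    ∃₂ λ xs ys → xs IsArrangementOf Above × ys IsArrangementOf Below × l ≡ xs ++ k ∷ ys
  sandwich-complete {l} len (range , u , dom)
    with ∈-∃++ (dominating-vertex-occurs n k l 1≤k k≤n len range dom)
  ... | xs , ys , refl with Unique-++⁻ xs u
  ... | uxs , k∉ys ∷ uys , disjoint = xs , ys , (uxs , xs⊆ , ⊆xs) , (uys , ys⊆ , ⊆ys) , refl
    where
    k∉xs : k ∉ xs
    k∉xs k∈xs = disjoint (k∈xs , here refl)
    k∉ys' : k ∉ ys
    k∉ys' = All¬⇒¬Any k∉ys
    -- an entry of l is a vertex of G_π, hence forms an inversion with k
    entry-dominated : ∀ {z} → z ∈ xs ++ k ∷ ys →
      z ≡ k ⊎ (k < z × Precedes (xs ++ k ∷ ys) z k) ⊎ (z < k × Precedes (xs ++ k ∷ ys) k z)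
    entry-dominated z∈ = let 1≤z , z≤top = All.lookup range z∈ in dom _ 1≤z z≤top
    xs⊆ : xs ⊆ Above
    xs⊆ z∈xs with entry-dominated (∈-++⁺ˡ z∈xs)
    ... | inj₁ refl = ⊥-elim (k∉xs z∈xs)
    ... | inj₂ (inj₁ (k<z , _)) = ∈-Above⁺ k<z (proj₂ (All.lookup range (∈-++⁺ˡ z∈xs)))
    ... | inj₂ (inj₂ (_ , k-before-z)) = ⊥-elim (disjoint (z∈xs , there (after-mid xs k∉xs k∉ys' k-before-z)))
    ys⊆ : ys ⊆ Below
    ys⊆ z∈ys with entry-dominated (∈-++⁺ʳ xs (there z∈ys))
    ... | inj₁ refl = ⊥-elim (k∉ys' z∈ys)
    ... | inj₂ (inj₁ (_ , z-before-k)) = ⊥-elim (disjoint (before-mid xs k∉ys' z-before-k , there z∈ys))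
    ... | inj₂ (inj₂ (z<k , _)) = ∈-Below⁺ (proj₁ (All.lookup range (∈-++⁺ʳ xs (there z∈ys)))) z<k
    ⊆xs : Above ⊆ xs
    ⊆xs z∈ with ∈-Above⁻ z∈
    ... | k<z , z≤top with dom _ (≤-trans 1≤k (<⇒≤ k<z)) z≤top
    ...   | inj₁ refl = ⊥-elim (<-irrefl refl k<z)
    ...   | inj₂ (inj₁ (_ , z-before-k)) = before-mid xs k∉ys' z-before-k
    ...   | inj₂ (inj₂ (z<k , _)) = ⊥-elim (<-asym k<z z<k)
    ⊆ys : Below ⊆ ys
    ⊆ys z∈ with ∈-Below⁻ z∈
    ... | 1≤z , z<k with dom _ 1≤z (≤-trans (<⇒≤ z<k) k≤n)
    ...   | inj₁ refl = ⊥-elim (<-irrefl refl z<k)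
    ...   | inj₂ (inj₁ (k<z , _)) = ⊥-elim (<-asym z<k k<z)
    ...   | inj₂ (inj₂ (_ , k-before-z)) = after-mid xs k∉xs k∉ys' k-before-z

module Enumeration (n k : ℕ) (1≤k : 1 ≤ k) (k≤n : k ≤ n) where
  open Sandwich n k 1≤k k≤n

  Shapes : List (List ℕ × List ℕ)
  Shapes = cartesianProduct (arrangements Above) (arrangements Below)

  glue : List ℕ × List ℕ → List ℕ
  glue (xs , ys) = xs ++ k ∷ ys

  Dominated : List (Vec ℕ n)
  Dominated = map (toVec n ∘ glue) Shapes

  ∈-Shapes⁻ : ∀ {s} → s ∈ Shapes → proj₁ s IsArrangementOf Above × proj₂ s IsArrangementOf Below
  ∈-Shapes⁻ {xs , ys} s∈ with ∈-cartesianProduct⁻ (arrangements Above) (arrangements Below) s∈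
  ... | xs∈ , ys∈ = arrangements-sound Above (Unique-interval _ _) xs∈ ,
                    arrangements-sound Below (Unique-interval _ _) ys∈

  length-glue : ∀ {s} → s ∈ Shapes → length (glue s) ≡ n
  length-glue {xs , ys} s∈ with ∈-cartesianProduct⁻ (arrangements Above) (arrangements Below) s∈
  ... | xs∈ , ys∈ = begin
    length (xs ++ k ∷ ys)          ≡⟨ length-++ xs ⟩
    length xs + suc (length ys)    ≡⟨ cong₂ (λ a b → a + suc b) (length-arrangement xs∈) (length-arrangement ys∈) ⟩
    (n ∸ k) + suc (k ∸ 1)          ≡⟨ cong ((n ∸ k) +_) (m+[n∸m]≡n 1≤k) ⟩
    (n ∸ k) + k                    ≡⟨ m∸n+n≡m k≤n ⟩
    n                              ∎
    where
    open ≡-Reasoning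
    length-arrangement : ∀ {lo len m} → m ∈ arrangements (interval lo len) → length m ≡ len
    length-arrangement {lo} {len} m∈ =
      trans (length-∈-arrangements (interval lo len) m∈) (length-applyUpTo (lo +_) len)

  k∉prefix : ∀ {s} → s ∈ Shapes → k ∉ proj₁ s
  k∉prefix s∈ k∈ = <-irrefl refl (proj₁ (∈-Above⁻ (proj₁ (proj₂ (proj₁ (∈-Shapes⁻ s∈))) k∈)))

  -- Glued words have length n, so their vectors determine them.
  toVec-glue-injective : ∀ {s t} → s ∈ Shapes → t ∈ Shapes →
    toVec n (glue s) ≡ toVec n (glue t) → glue s ≡ glue t
  toVec-glue-injective {s} {t} s∈ t∈ eq = begin
    glue s                   ≡⟨ toList-toVec n (glue s) (length-glue s∈) ⟨
    toList (toVec n (glue s)) ≡⟨ cong toList eq ⟩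
    toList (toVec n (glue t)) ≡⟨ toList-toVec n (glue t) (length-glue t∈) ⟩
    glue t                   ∎
    where open ≡-Reasoning

  -- Distinct shapes give distinct vectors, as a word splits uniquely around k.
  glue-injective : ∀ {s t} → s ∈ Shapes → t ∈ Shapes → toVec n (glue s) ≡ toVec n (glue t) → s ≡ t
  glue-injective {xs , _} {xs' , _} s∈ t∈ eq
    with split-unique xs xs' (k∉prefix s∈) (k∉prefix t∈) (toVec-glue-injective s∈ t∈ eq)
  ... | refl , refl = refl

  Unique-Dominated : Unique Dominated
  Unique-Dominated = Unique-map (toVec n ∘ glue) glue-injective
    (cartesianProduct⁺ (Unique-arrangements Above (Unique-interval _ _))
                       (Unique-arrangements Below (Unique-interval _ _)))

  ∈-Dominated⇔ : (π : Vec ℕ n) → π ∈ Dominated ⇔ (IsPermutation π × Dominates π (Singleton k))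
  ∈-Dominated⇔ π = mk⇔ to from
    where
    to : π ∈ Dominated → IsPermutation π × Dominates π (Singleton k)
    to π∈ with ∈-map⁻ (toVec n ∘ glue) π∈
    ... | s , s∈ , refl
      with subst Good (sym (toList-toVec n (glue s) (length-glue s∈)))
                 (sandwich-sound (proj₁ (∈-Shapes⁻ s∈)) (proj₂ (∈-Shapes⁻ s∈)))
    ... | range , u , dom = (range , u) , KDominated⇒dominates π dom
    from : IsPermutation π × Dominates π (Singleton k) → π ∈ Dominated
    from ((range , u) , dom)
      with sandwich-complete (length-toList π) (range , u , dominates⇒KDominated π dom)
    ... | xs , ys , xs-arr , ys-arr , π≡ =
      subst (_∈ Dominated) (trans (cong (toVec n) (sym π≡)) (toVec-toList π))
        (∈-map⁺ (toVec n ∘ glue)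
          (∈-cartesianProduct⁺ (arrangements-complete Above (Unique-interval _ _) xs-arr)
                               (arrangements-complete Below (Unique-interval _ _) ys-arr)))

  length-Dominated : length Dominated ≡ (n ∸ k) ! * (k ∸ 1) !
  length-Dominated = begin
    length (map (toVec n ∘ glue) Shapes)                       ≡⟨ length-map (toVec n ∘ glue) Shapes ⟩
    length Shapes                                              ≡⟨ length-cartesianProduct (arrangements Above) (arrangements Below) ⟩
    length (arrangements Above) * length (arrangements Below)  ≡⟨ cong₂ _*_ (length-arrangements Above) (length-arrangements Below) ⟩
    length Above ! * length Below !                            ≡⟨ cong₂ (λ a b → a ! * b !) (length-applyUpTo (suc k +_) (n ∸ k)) (length-applyUpTo (1 +_) (k ∸ 1)) ⟩
    (n ∸ k) ! * (k ∸ 1) !                                      ∎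
    where open ≡-Reasoning

proposition1 : (n k : ℕ) → 1 ≤ k → k ≤ n →
    Σ (List (Vec ℕ n)) λ L →
      Unique L ×
      ((π : Vec ℕ n) → (π ∈ L) ⇔ (IsPermutation π × Dominates π (Singleton k))) ×
      length L ≡ ((n ∸ k) !) * ((k ∸ 1) !)
proposition1 n k 1≤k k≤n = Dominated , Unique-Dominated , ∈-Dominated⇔ , length-Dominated
  where open Enumeration n k 1≤k k≤n
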